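{- For all integers $0\le d\le t$ we have $s(H_{t,d})\ge d^2$.
   Context: All graphs are finite and simple. For graphs $F$ and $H$, write $F\to H$ if every coloring of the edges of $F$ with two colors contains a monochromatic copy (subgraph isomorphic to) $H$. $F$ is Ramsey $H$-minimal if $F\to H$ and no proper subgraph $F'$ of $F$ satisfies $F'\to H$; $\mathcal{M}(H)$ denotes the set of such graphs. Define $s(H)=\min_{F\in\mathcal{M}(H)}\delta(F)$, where $\delta(F)$ is the minimum degree of $F$. For $0\le d\le t$, $H_{t,d}$ is the graph on $t+1$ vertices consisting of a complete graph $K_t$ together with one additional vertex adjacent to exactly $d$ vertices of the $K_t$. -}

module Defs where

open import Data.Nat using (ℕ; zero; suc; _<ᵇ_; _*_; _≤_)
open import Data.Fin using (Fin; zero; suc; toℕ)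
open import Data.Fin.Properties using (_≟_)
open import Data.Bool using (Bool; true; false; not)
open import Data.List using (length; filterᵇ; allFin)
open import Data.Product using (Σ; ∃; ∃-syntax; _×_; _,_)
open import Relation.Binary.PropositionalEquality using (_≡_; refl; sym)
open import Relation.Nullary using (¬_; does)
open import Function.Definitions using (Injective; Surjective)

record Graph (n : ℕ) : Set where
  field
    adj   : Fin n → Fin n → Bool
    adj-sym : ∀ u v → adj u v ≡ adj v u
    loopless : ∀ v → adj v v ≡ false
open Graph public

record Embedding {m n : ℕ} (G : Graph m) (F : Graph n) : Set where
  field
    map      : Fin m → Fin n
    injective : Injective _≡_ _≡_ map
    preserves : ∀ u v → adj G u v ≡ true → adj F (map u) (map v) ≡ true
open Embedding public

-- A 2-colouring of the edges of F (given as a symmetric colouring of pairs;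
-- only the values on edges of F matter).
record Colouring {n : ℕ} (F : Graph n) : Set where
  field
    colour : Fin n → Fin n → Bool
    colour-sym : ∀ u v → colour u v ≡ colour v u
open Colouring public

MonoCopy : {n k : ℕ} (F : Graph n) (c : Colouring F) (H : Graph k) (col : Bool) → Set
MonoCopy F c H col =
  Σ (Embedding H F) λ e → ∀ u v → adj H u v ≡ true → colour c (map e u) (map e v) ≡ col

Arrows : {n k : ℕ} (F : Graph n) (H : Graph k) → Set
Arrows F H = (c : Colouring F) → ∃[ col ] MonoCopy F c H col

-- G is a proper subgraph of F via the embedding e: e is not an isomorphism
-- (i.e. not both surjective on vertices and edge-reflecting).
Proper : {m n : ℕ} {G : Graph m} {F : Graph n} → Embedding G F → Set
Proper {G = G} {F = F} e =
  ¬ (Surjective _≡_ _≡_ (map e) ×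
     (∀ u v → adj F (map e u) (map e v) ≡ true → adj G u v ≡ true))

RamseyMinimal : {n k : ℕ} (F : Graph n) (H : Graph k) → Set
RamseyMinimal {n} F H =
  Arrows F H ×
  (∀ (m : ℕ) (G : Graph m) (e : Embedding G F) → Proper e → ¬ Arrows G H)

degree : {n : ℕ} (F : Graph n) → Fin n → ℕ
degree F v = length (filterᵇ (adj F v) (allFin _))

MinDegreeAtLeast : {n : ℕ} (F : Graph n) → ℕ → Set
MinDegreeAtLeast F r = ∀ v → r ≤ degree F v

-- H_{t,d}: vertex zero is the extra vertex; vertices suc i (i : Fin t) form K_t;
-- zero is adjacent to suc i iff toℕ i < d (exactly min(d,t) = d such vertices when d ≤ t).
Hadj : (t d : ℕ) → Fin (suc t) → Fin (suc t) → Bool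
Hadj t d zero zero = false
Hadj t d zero (suc i) = toℕ i <ᵇ d
Hadj t d (suc i) zero = toℕ i <ᵇ d
Hadj t d (suc i) (suc j) = not (does (i ≟ j))

private
  neq-sym : ∀ {t} (i j : Fin t) → not (does (i ≟ j)) ≡ not (does (j ≟ i))
  neq-sym i j with i ≟ j | j ≟ i
  ... | Relation.Nullary.yes _ | Relation.Nullary.yes _ = refl
  ... | Relation.Nullary.no _ | Relation.Nullary.no _ = refl
  ... | Relation.Nullary.yes p | Relation.Nullary.no q = Data.Empty.⊥-elim (q (sym p))
    where import Data.Empty
  ... | Relation.Nullary.no p | Relation.Nullary.yes q = Data.Empty.⊥-elim (p (sym q))
    where import Data.Empty

  neq-irr : ∀ {t} (i : Fin t) → not (does (i ≟ i)) ≡ false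
  neq-irr i with i ≟ i
  ... | Relation.Nullary.yes _ = refl
  ... | Relation.Nullary.no q = Data.Empty.⊥-elim (q refl)
    where import Data.Empty

Hsym : ∀ t d u v → Hadj t d u v ≡ Hadj t d v u
Hsym t d zero zero = refl
Hsym t d zero (suc i) = refl
Hsym t d (suc i) zero = refl
Hsym t d (suc i) (suc j) = neq-sym i j

Hloop : ∀ t d v → Hadj t d v v ≡ false
Hloop t d zero = refl
Hloop t d (suc i) = neq-irr i

H : (t d : ℕ) → Graph (suc t)
H t d = record { adj = Hadj t d ; adj-sym = Hsym t d ; loopless = Hloop t d }

-- Let F be Ramsey H_{t,d}-minimal with 1 ≤ d ≤ t, and suppose a vertex v has
-- fewer than d² neighbours; we show F − v → H_{t,d}, contradicting minimality.
-- Given a 2-colouring of F − v, the splitting lemma cuts the neighbourhood N of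
-- v into a part R without red K_d and a part N ∖ R without blue K_d: greedily
-- remove the vertices of red K_d's; each such set meets a blue clique in at
-- most one vertex, and since |N| < d·d fewer than d removals happen.  Colour
-- the edges from v to R red and those to N ∖ R blue.  As F → H_{t,d}, there is
-- a monochromatic copy of H_{t,d}; it cannot pass through v, because every
-- vertex of H_{t,d} has d pairwise adjacent neighbours, whose images would form
-- a monochromatic K_d in R or in N ∖ R.  So the copy lies in F − v.
module Submission where

open import Defs
open import Data.Nat using (ℕ; zero; suc; _+_; _*_; _≤_; _<_; z≤n; s≤s)
open import Data.Nat.Properties using (_≤?_; _<?_; ≰⇒>; <⇒≱; ≤-refl; ≤-trans; n≤1+n; m≤n⇒m≤1+n; +-suc; +-mono-≤; *-identityˡ; <⇒<ᵇ; ≤-<-trans; module ≤-Reasoning)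
open import Data.Bool using (Bool; true; false; _∧_; _∨_; not)
open import Data.Bool.Properties using (∨-zeroʳ; ∧-conicalˡ; ∧-conicalʳ; not-injective; not-¬; ¬-not; T-≡)
import Data.Bool as B
open import Data.Fin using (Fin; zero; suc; toℕ; punchIn; punchOut; inject≤)
open import Data.Fin.Properties using (_≟_; suc-injective; any?; punchIn-injective; punchInᵢ≢i; punchIn-punchOut; punchOut-cong; punchOut-injective; inject≤-injective; toℕ-inject≤; toℕ<n)
open import Data.List using (length; filterᵇ; tabulate)
open import Data.Product using (Σ; ∃; _×_; _,_; uncurry)
open import Data.Sum using (_⊎_; inj₁; inj₂)
open import Data.Empty using (⊥-elim)
open import Data.Unit using (⊤; tt)
open import Function using (_∘_; id)
open import Function.Bundles using (Equivalence)
open import Relation.Nullary using (¬_; Dec; yes; no; does)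
open import Relation.Nullary.Decidable using (_×-dec_; dec-true; dec-false)
open import Relation.Binary.PropositionalEquality

private
  variable
    m : ℕ

witness : {A : Set} (a? : Dec A) → does a? ≡ true → A
witness (yes a) _ = a

VertexSet : ℕ → Set
VertexSet m = Fin m → Bool

infix 4 _∈_ _∉_ _⊆_
infixl 6 _∖_
infixl 7 _∩_

_∈_ _∉_ : Fin m → VertexSet m → Set
x ∈ S = S x ≡ true
x ∉ S = S x ≡ false

_⊆_ : VertexSet m → VertexSet m → Set
S ⊆ T = ∀ x → x ∈ S → x ∈ T

-- The set operations are opaque, so that membership goals keep their shape
-- and the sets involved can be inferred; only the basic rules below unfold them.
opaque
  _∩_ _∖_ _∪_ : VertexSet m → VertexSet m → VertexSet m
  (S ∩ T) x = S x ∧ T x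
  (S ∖ T) x = S x ∧ not (T x)
  (S ∪ T) x = S x ∨ T x

  ⁅_⁆ : Fin m → VertexSet m
  ⁅ x ⁆ y = does (x ≟ y)

opaque
  unfolding _∩_

  ∩-intro : {S T : VertexSet m} {x : Fin m} → x ∈ S → x ∈ T → x ∈ S ∩ T
  ∩-intro = cong₂ _∧_

  ∩-left : {S T : VertexSet m} {x : Fin m} → x ∈ S ∩ T → x ∈ S
  ∩-left = ∧-conicalˡ _ _

  ∩-right : {S T : VertexSet m} {x : Fin m} → x ∈ S ∩ T → x ∈ T
  ∩-right = ∧-conicalʳ _ _

opaque
  unfolding _∖_

  ∖-intro : {S T : VertexSet m} {x : Fin m} → x ∈ S → x ∉ T → x ∈ S ∖ T
  ∖-intro x∈S x∉T = cong₂ _∧_ x∈S (cong not x∉T)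

  ∖-left : {S T : VertexSet m} {x : Fin m} → x ∈ S ∖ T → x ∈ S
  ∖-left = ∧-conicalˡ _ _

  ∖-right : {S T : VertexSet m} {x : Fin m} → x ∈ S ∖ T → x ∉ T
  ∖-right h = not-injective (∧-conicalʳ _ _ h)

opaque
  unfolding _∪_

  ∪-introˡ : {S T : VertexSet m} {x : Fin m} → x ∈ S → x ∈ S ∪ T
  ∪-introˡ x∈S = cong (_∨ _) x∈S

  ∪-introʳ : {S T : VertexSet m} {x : Fin m} → x ∈ T → x ∈ S ∪ T
  ∪-introʳ {S = S} {x = x} x∈T = trans (cong (S x ∨_) x∈T) (∨-zeroʳ (S x))

  ∪-elim : {S T : VertexSet m} {x : Fin m} → x ∈ S ∪ T → x ∈ S ⊎ x ∈ T
  ∪-elim {S = S} {x = x} h with S x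
  ... | true  = inj₁ refl
  ... | false = inj₂ h

opaque
  unfolding ⁅_⁆

  ∈-⁅⁆ : (x : Fin m) → x ∈ ⁅ x ⁆
  ∈-⁅⁆ x = dec-true (x ≟ x) refl

  ∉-⁅⁆ : {x y : Fin m} → x ≢ y → y ∉ ⁅ x ⁆
  ∉-⁅⁆ {x = x} {y} = dec-false (x ≟ y)

  ∈-⁅⁆⁻¹ : {x y : Fin m} → y ∈ ⁅ x ⁆ → x ≡ y
  ∈-⁅⁆⁻¹ {x = x} {y} = witness (x ≟ y)

module _ {S T U : VertexSet m} where

  ∩-monoˡ : S ⊆ T → S ∩ U ⊆ T ∩ U
  ∩-monoˡ S⊆T x h = ∩-intro (S⊆T x (∩-left h)) (∩-right h)

  ∖-∩-swap : (S ∩ U) ∖ T ⊆ (S ∖ T) ∩ U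
  ∖-∩-swap x h = ∩-intro (∖-intro (∩-left (∖-left h)) (∖-right h)) (∩-right (∖-left h))

  ∖-swap : (S ∖ U) ∖ T ⊆ (S ∖ T) ∖ U
  ∖-swap x h = ∖-intro (∖-intro (∖-left (∖-left h)) (∖-right h)) (∖-right (∖-left h))

∪-⁅⁆-⊆ : {S T : VertexSet m} {x : Fin m} → S ⊆ T → x ∈ T → S ∪ ⁅ x ⁆ ⊆ T
∪-⁅⁆-⊆ {T = T} S⊆T x∈T y h with ∪-elim h
... | inj₁ y∈S = S⊆T y y∈S
... | inj₂ y∈x = subst (_∈ T) (∈-⁅⁆⁻¹ y∈x) x∈T

∖-self : {S : VertexSet m} {x : Fin m} → ¬ x ∈ S ∖ S
∖-self h with trans (sym (∖-left h)) (∖-right h)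
... | ()

size : VertexSet m → ℕ
size {zero}  S = 0
size {suc m} S with S zero
... | true  = suc (size (S ∘ suc))
... | false = size (S ∘ suc)

size-mono : {S T : VertexSet m} → S ⊆ T → size S ≤ size T
size-mono {zero} S⊆T = z≤n
size-mono {suc m} {S} {T} S⊆T with S zero in s0 | T zero in t0
... | true  | true  = s≤s (size-mono (S⊆T ∘ suc))
... | false | true  = m≤n⇒m≤1+n (size-mono (S⊆T ∘ suc))
... | false | false = size-mono (S⊆T ∘ suc)
... | true  | false with trans (sym (S⊆T zero s0)) t0
...   | ()

opaque
  unfolding _∩_ _∖_

  size-split : (S T : VertexSet m) → size S ≡ size (S ∩ T) + size (S ∖ T)
  size-split {zero} S T = refl
  size-split {suc m} S T with S zero | T zero
  ... | true  | true  = cong suc (size-split (S ∘ suc) (T ∘ suc))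
  ... | true  | false = trans (cong suc (size-split (S ∘ suc) (T ∘ suc))) (sym (+-suc _ _))
  ... | false | _     = size-split (S ∘ suc) (T ∘ suc)

size-member : {S : VertexSet m} (x : Fin m) → x ∈ S → 1 ≤ size S
size-member zero x∈S rewrite x∈S = s≤s z≤n
size-member {S = S} (suc x) x∈S with S zero
... | true  = s≤s z≤n
... | false = size-member x x∈S

size-insert : {Q : VertexSet m} (x : Fin m) → x ∉ Q → suc (size Q) ≤ size (Q ∪ ⁅ x ⁆)
size-insert {Q = Q} x x∉Q = begin
  1 + size Q                              ≤⟨ +-mono-≤ (size-member x x∈Q⁺∩x) (size-mono Q⊆Q⁺∖x) ⟩
  size (Q⁺ ∩ ⁅ x ⁆) + size (Q⁺ ∖ ⁅ x ⁆)  ≡⟨ sym (size-split Q⁺ ⁅ x ⁆) ⟩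
  size Q⁺                                 ∎
  where
  open ≤-Reasoning
  Q⁺ : VertexSet _
  Q⁺ = Q ∪ ⁅ x ⁆
  x∈Q⁺∩x : x ∈ Q⁺ ∩ ⁅ x ⁆
  x∈Q⁺∩x = ∩-intro (∪-introʳ (∈-⁅⁆ x)) (∈-⁅⁆ x)
  Q⊆Q⁺∖x : Q ⊆ Q⁺ ∖ ⁅ x ⁆
  Q⊆Q⁺∖x y y∈Q = ∖-intro (∪-introˡ y∈Q) (∉-⁅⁆ x≢y)
    where
    x≢y : x ≢ y
    x≢y refl with trans (sym x∉Q) y∈Q
    ... | ()

size-punchIn : (S : VertexSet (suc m)) (v : Fin (suc m)) → size (S ∘ punchIn v) ≤ size S
size-punchIn S zero with S zero
... | true  = n≤1+n _
... | false = ≤-refl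
size-punchIn {suc m} S (suc v) with S zero
... | true  = s≤s (size-punchIn (S ∘ suc) v)
... | false = size-punchIn (S ∘ suc) v

length-filter-tabulate : {A : Set} (p : A → Bool) (g : Fin m → A) →
                         length (filterᵇ p (tabulate g)) ≡ size (p ∘ g)
length-filter-tabulate {zero}  p g = refl
length-filter-tabulate {suc m} p g with p (g zero)
... | true  = cong suc (length-filter-tabulate p (g ∘ suc))
... | false = length-filter-tabulate p (g ∘ suc)

degree-size : {n : ℕ} (F : Graph n) (v : Fin n) → degree F v ≡ size (adj F v)
degree-size F v = length-filter-tabulate (adj F v) id

module Cliques {m : ℕ} (G : Graph m) (c : Colouring G) where

  Nbr : Bool → Fin m → VertexSet m
  Nbr col x = adj G x ∩ λ y → does (colour c x y B.≟ col)

  module _ {col : Bool} {x y : Fin m} where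

    nbr-intro : adj G x y ≡ true → colour c x y ≡ col → y ∈ Nbr col x
    nbr-intro xy col-xy = ∩-intro xy (dec-true (colour c x y B.≟ col) col-xy)

    nbr-adj : y ∈ Nbr col x → adj G x y ≡ true
    nbr-adj = ∩-left

    nbr-colour : y ∈ Nbr col x → colour c x y ≡ col
    nbr-colour h = witness (colour c x y B.≟ col) (∩-right h)

  nbr-irreflexive : ∀ {col x} → ¬ x ∈ Nbr col x
  nbr-irreflexive {x = x} h with trans (sym (nbr-adj h)) (loopless G x)
  ... | ()

  -- `HasClique col S k': S contains k vertices pairwise joined by edges of
  -- colour col; recursively, a vertex x ∈ S and a (k-1)-clique among the
  -- col-neighbours of x in S.  This form makes the property decidable.
  HasClique : Bool → VertexSet m → ℕ → Set
  HasClique col S zero    = ⊤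
  HasClique col S (suc k) = ∃ λ x → x ∈ S × HasClique col (S ∩ Nbr col x) k

  hasClique? : ∀ col S k → Dec (HasClique col S k)
  hasClique? col S zero    = yes tt
  hasClique? col S (suc k) =
    any? λ x → (S x B.≟ true) ×-dec hasClique? col (S ∩ Nbr col x) k

  hasClique-mono : ∀ {col S T} k → S ⊆ T → HasClique col S k → HasClique col T k
  hasClique-mono zero    S⊆T _             = tt
  hasClique-mono (suc k) S⊆T (x , x∈S , K) = x , S⊆T x x∈S , hasClique-mono k (∩-monoˡ S⊆T) K

  clique-from-vertices : ∀ {col S} k (g : Fin k → Fin m) → (∀ i → g i ∈ S) →
    (∀ i j → i ≢ j → adj G (g i) (g j) ≡ true × colour c (g i) (g j) ≡ col) →
    HasClique col S k
  clique-from-vertices zero    g g∈S g-clique = tt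
  clique-from-vertices (suc k) g g∈S g-clique =
    g zero , g∈S zero ,
    clique-from-vertices k (g ∘ suc)
      (λ i → ∩-intro (g∈S (suc i)) (uncurry nbr-intro (g-clique zero (suc i) λ ())))
      (λ i j i≢j → g-clique (suc i) (suc j) (i≢j ∘ suc-injective))

  Monochromatic : Bool → VertexSet m → Set
  Monochromatic col Q = ∀ x y → x ∈ Q → y ∈ Q → adj G x y ≡ true → colour c x y ≡ col

  insert-monochromatic : ∀ {col Q x} → Q ⊆ Nbr col x → Monochromatic col Q →
                         Monochromatic col (Q ∪ ⁅ x ⁆)
  insert-monochromatic {col} {Q} {x} Q⊆N Qmono y z y∈ z∈ yz with ∪-elim y∈ | ∪-elim z∈
  ... | inj₁ y∈Q | inj₁ z∈Q = Qmono y z y∈Q z∈Q yz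
  ... | inj₁ y∈Q | inj₂ z∈x rewrite sym (∈-⁅⁆⁻¹ z∈x) =
    trans (colour-sym c y x) (nbr-colour (Q⊆N y y∈Q))
  ... | inj₂ y∈x | inj₁ z∈Q rewrite sym (∈-⁅⁆⁻¹ y∈x) = nbr-colour (Q⊆N z z∈Q)
  ... | inj₂ y∈x | inj₂ z∈x rewrite sym (∈-⁅⁆⁻¹ y∈x) | sym (∈-⁅⁆⁻¹ z∈x)
    with trans (sym yz) (loopless G x)
  ...   | ()

  clique-support : ∀ {col S} k → HasClique col S k →
    Σ (VertexSet m) λ Q → Q ⊆ S × Monochromatic col Q × k ≤ size Q
  clique-support zero _ = (λ _ → false) , (λ _ ()) , (λ _ _ ()) , z≤n
  clique-support (suc k) (x , x∈S , K) with clique-support k K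
  ... | Q , Q⊆S∩N , Qmono , k≤Q =
    Q ∪ ⁅ x ⁆ ,
    ∪-⁅⁆-⊆ (λ y → ∩-left ∘ Q⊆S∩N y) x∈S ,
    insert-monochromatic (λ y → ∩-right ∘ Q⊆S∩N y) Qmono ,
    ≤-trans (s≤s k≤Q) (size-insert x (¬-not (nbr-irreflexive ∘ ∩-right ∘ Q⊆S∩N x)))

  clique-size : ∀ {col S} k → HasClique col S k → k ≤ size S
  clique-size k K with clique-support k K
  ... | Q , Q⊆S , _ , k≤Q = ≤-trans k≤Q (size-mono Q⊆S)

  nbr-outside : ∀ {col Q x y} → Monochromatic col Q → x ∈ Q → y ∈ Nbr (not col) x → y ∉ Q
  nbr-outside {x = x} {y} Qmono x∈Q h =
    ¬-not λ y∈Q → not-¬ refl (trans (sym (Qmono x y x∈Q y∈Q (nbr-adj h))) (nbr-colour h))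

  -- A col-monochromatic set meets a clique of the other colour in at most one
  -- vertex, so removing it shrinks such cliques by at most one.
  meets-once : ∀ {col Q S} k → Monochromatic col Q →
               HasClique (not col) S (suc k) → HasClique (not col) (S ∖ Q) k
  meets-once zero _ _ = tt
  meets-once {Q = Q} (suc k) Qmono (x , x∈S , K) with Q x in x∈?Q
  ... | true  = hasClique-mono (suc k)
                  (λ y h → ∖-intro (∩-left h) (nbr-outside Qmono x∈?Q (∩-right h))) K
  ... | false = x , ∖-intro x∈S x∈?Q , hasClique-mono k ∖-∩-swap (meets-once k Qmono K)

-- The splitting lemma: a vertex set with fewer than (j+1)·r vertices splits
-- into a part without red K_r and a part without blue K_(j+1).  Red is `true'.
module Splitting {m : ℕ} (G : Graph m) (c : Colouring G) (r : ℕ) where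
  open Cliques G c

  GoodSplit : VertexSet m → ℕ → Set
  GoodSplit S j = Σ (VertexSet m) λ R → ¬ HasClique true R r × ¬ HasClique false (S ∖ R) (suc j)

  SplitOrLarge : VertexSet m → ℕ → Set
  SplitOrLarge S j = GoodSplit S j ⊎ suc j * r ≤ size S

  -- Removing a red-monochromatic Q ⊆ S with at least r vertices: a good split
  -- of S ∖ Q for j is one of S for j + 1, since Q meets blue cliques at most once.
  split-around : ∀ {j S Q} → Q ⊆ S → Monochromatic true Q → r ≤ size Q →
                 SplitOrLarge (S ∖ Q) j → SplitOrLarge S (suc j)
  split-around {j} _ Qred _ (inj₁ (R , noRed , noBlue)) =
    inj₁ (R , noRed , noBlue ∘ hasClique-mono (suc j) ∖-swap ∘ meets-once (suc j) Qred)
  split-around {j} {S} {Q} Q⊆S _ r≤Q (inj₂ large) = inj₂ (begin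
    r + suc j * r                ≤⟨ +-mono-≤ (≤-trans r≤Q (size-mono Q⊆S∩Q)) large ⟩
    size (S ∩ Q) + size (S ∖ Q)  ≡⟨ sym (size-split S Q) ⟩
    size S                       ∎)
    where
    open ≤-Reasoning
    Q⊆S∩Q : Q ⊆ S ∩ Q
    Q⊆S∩Q x x∈Q = ∩-intro (Q⊆S x x∈Q) x∈Q

  split : ∀ j S → SplitOrLarge S j
  split j S with hasClique? true S r
  ... | no noRed = inj₁ (S , noRed , λ (x , x∈S∖S , _) → ∖-self x∈S∖S)
  split zero    S | yes red = inj₂ (subst (_≤ size S) (sym (*-identityˡ r)) (clique-size r red))
  split (suc j) S | yes red =
    let (Q , Q⊆S , Qred , r≤Q) = clique-support r red
    in  split-around Q⊆S Qred r≤Q (split j (S ∖ Q))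

  split-small : ∀ j S → size S < suc j * r → GoodSplit S j
  split-small j S small with split j S
  ... | inj₁ good  = good
  ... | inj₂ large = ⊥-elim (<⇒≱ small large)

toℕ-punchIn : {n : ℕ} (i : Fin (suc n)) (j : Fin n) → toℕ (punchIn i j) ≤ suc (toℕ j)
toℕ-punchIn zero    j       = ≤-refl
toℕ-punchIn (suc i) zero    = z≤n
toℕ-punchIn (suc i) (suc j) = s≤s (toℕ-punchIn i j)

module NeighbourCliques {t d : ℕ} (d≤t : d ≤ t) where

  adj-Kt : {a b : Fin t} → a ≢ b → Hadj t d (suc a) (suc b) ≡ true
  adj-Kt {a} {b} a≢b = cong not (dec-false (a ≟ b) a≢b)

  -- The vertices 0, …, d (the extra vertex and its neighbours) form a K_(d+1).
  adj-low : {u u′ : Fin (suc t)} → u ≢ u′ → toℕ u ≤ d → toℕ u′ ≤ d → Hadj t d u u′ ≡ true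
  adj-low {zero}  {zero}   u≢u′ _   _   = ⊥-elim (u≢u′ refl)
  adj-low {zero}  {suc b}  _    _   b<d = Equivalence.to T-≡ (<⇒<ᵇ b<d)
  adj-low {suc a} {zero}   _    a<d _   = Equivalence.to T-≡ (<⇒<ᵇ a<d)
  adj-low {suc a} {suc b}  u≢u′ _   _   = adj-Kt (u≢u′ ∘ cong suc)

  -- The first d vertices of the K_t, i.e. the neighbours of the extra vertex.
  low : Fin d → Fin t
  low k = inject≤ k d≤t

  toℕ-low : (k : Fin d) → toℕ (low k) < d
  toℕ-low k = subst (_< d) (sym (toℕ-inject≤ k d≤t)) (toℕ<n k)

  low-injective : {k l : Fin d} → k ≢ l → low k ≢ low l
  low-injective k≢l = k≢l ∘ inject≤-injective d≤t d≤t _ _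

  NeighbourClique : Fin (suc t) → Set
  NeighbourClique x = Σ (Fin d → Fin (suc t)) λ w →
    (∀ k → Hadj t d x (w k) ≡ true) × (∀ k l → k ≢ l → Hadj t d (w k) (w l) ≡ true)

  -- A vertex among 0, …, d sees the other d of them.
  low-neighbour-clique : (x : Fin (suc t)) → toℕ x ≤ d → NeighbourClique x
  low-neighbour-clique x x≤d = w , (λ k → adj-low (x≢w k) x≤d (w≤d k)) ,
    λ k l k≢l → adj-low (low-injective k≢l ∘ punchIn-injective x _ _) (w≤d k) (w≤d l)
    where
    w : Fin d → Fin (suc t)
    w = punchIn x ∘ low
    w≤d : ∀ k → toℕ (w k) ≤ d
    w≤d k = ≤-trans (toℕ-punchIn x (low k)) (toℕ-low k)
    x≢w : ∀ k → x ≢ w k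
    x≢w k = punchInᵢ≢i x (low k) ∘ sym

  -- A vertex of the K_t beyond the first d sees the first d.
  high-neighbour-clique : (i : Fin t) → ¬ toℕ i < d → NeighbourClique (suc i)
  high-neighbour-clique i i≮d = suc ∘ low , (λ k → adj-Kt (i≢low k)) ,
    λ k l k≢l → adj-Kt (low-injective k≢l)
    where
    i≢low : ∀ k → i ≢ low k
    i≢low k refl = i≮d (toℕ-low k)

  neighbour-clique : (x : Fin (suc t)) → NeighbourClique x
  neighbour-clique zero = low-neighbour-clique zero z≤n
  neighbour-clique (suc i) with toℕ i <? d
  ... | yes i<d = low-neighbour-clique (suc i) i<d
  ... | no  i≮d = high-neighbour-clique i i≮d

-- Deleting a vertex v from F.  Vertex i of F − v is the vertex punchIn v i of F,
-- and a vertex a of F with p : v ≢ a is the vertex punchOut p of F − v.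
module Deletion {n : ℕ} (F : Graph (suc n)) (v : Fin (suc n)) where

  F-v : Graph n
  F-v = record
    { adj      = λ i j → adj F (punchIn v i) (punchIn v j)
    ; adj-sym  = λ i j → adj-sym F (punchIn v i) (punchIn v j)
    ; loopless = λ i → loopless F (punchIn v i)
    }

  deletion : Embedding F-v F
  deletion = record
    { map       = punchIn v
    ; injective = punchIn-injective v _ _
    ; preserves = λ i j ij → ij
    }

  -- F − v is a proper subgraph: v is not in the image.
  deletion-proper : Proper deletion
  deletion-proper (surjective , _) with surjective v
  ... | i , hits-v = punchInᵢ≢i v i (hits-v refl)

  adj-F-v : {a b : Fin (suc n)} (p : v ≢ a) (q : v ≢ b) →
            adj F-v (punchOut p) (punchOut q) ≡ adj F a b
  adj-F-v p q = cong₂ (adj F) (punchIn-punchOut p) (punchIn-punchOut q)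

  -- A colouring c of F − v together with colours R i for the edges between v
  -- and punchIn v i is a colouring of F.
  module Extension (c : Colouring F-v) (R : VertexSet n) where

    -- Colour by cases on whether the endpoints are v; an edge v–v never occurs.
    colour′ : {a b : Fin (suc n)} → Dec (v ≡ a) → Dec (v ≡ b) → Bool
    colour′ (yes _) (yes _) = false
    colour′ (yes _) (no q)  = R (punchOut q)
    colour′ (no p)  (yes _) = R (punchOut p)
    colour′ (no p)  (no q)  = colour c (punchOut p) (punchOut q)

    colour′-sym : {a b : Fin (suc n)} (a? : Dec (v ≡ a)) (b? : Dec (v ≡ b)) →
                  colour′ a? b? ≡ colour′ b? a?
    colour′-sym (yes _) (yes _) = refl
    colour′-sym (yes _) (no _)  = refl
    colour′-sym (no _)  (yes _) = refl
    colour′-sym (no p)  (no q)  = colour-sym c (punchOut p) (punchOut q)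

    extended : Colouring F
    extended = record
      { colour     = λ a b → colour′ (v ≟ a) (v ≟ b)
      ; colour-sym = λ a b → colour′-sym (v ≟ a) (v ≟ b)
      }

    extended-inner : {a b : Fin (suc n)} (p : v ≢ a) (q : v ≢ b) →
                     colour extended a b ≡ colour c (punchOut p) (punchOut q)
    extended-inner {a} {b} p q with v ≟ a | v ≟ b
    ... | yes v≡a | _       = ⊥-elim (p v≡a)
    ... | no _    | yes v≡b = ⊥-elim (q v≡b)
    ... | no _    | no _    = cong₂ (colour c) (punchOut-cong v refl) (punchOut-cong v refl)

    extended-spoke : {b : Fin (suc n)} (q : v ≢ b) → colour extended v b ≡ R (punchOut q)
    extended-spoke {b} q with v ≟ v | v ≟ b
    ... | no v≢v | _       = ⊥-elim (v≢v refl)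
    ... | yes _  | yes v≡b = ⊥-elim (q v≡b)
    ... | yes _  | no _    = cong R (punchOut-cong v refl)

    avoiding-copy : {k : ℕ} {K : Graph k} {col : Bool} (e : Embedding K F) →
      (avoids : ∀ u → v ≢ map e u) →
      (∀ u u′ → adj K u u′ ≡ true → colour extended (map e u) (map e u′) ≡ col) →
      MonoCopy F-v c K col
    avoiding-copy e avoids mono = e-v , λ u u′ uu′ →
      trans (sym (extended-inner (avoids u) (avoids u′))) (mono u u′ uu′)
      where
      e-v : Embedding _ F-v
      e-v = record
        { map       = λ u → punchOut (avoids u)
        ; injective = λ {u} {u′} eq → injective e (punchOut-injective (avoids u) (avoids u′) eq)
        ; preserves = λ u u′ uu′ →
            trans (adj-F-v (avoids u) (avoids u′)) (preserves e u u′ uu′)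
        }

module LowDegreeDeletion {t d′ n : ℕ} (d≤t : suc d′ ≤ t) (F : Graph (suc n)) (v : Fin (suc n)) where
  open Deletion F v
  open NeighbourCliques d≤t

  private
    d : ℕ
    d = suc d′

  N : VertexSet n
  N i = adj F v (punchIn v i)

  -- Deleting v itself from the domain of adj F v keeps N small.
  N-small : degree F v < d * d → size N < d * d
  N-small small = ≤-<-trans (size-punchIn (adj F v) v) (subst (_< d * d) (degree-size F v) small)

  module _ (c : Colouring F-v) (R : VertexSet n) where
    open Extension c R
    open Cliques F-v c

    Spokes : Bool → VertexSet n
    Spokes col = N ∩ λ i → does (R i B.≟ col)

    -- A monochromatic copy of H_{t,d} through v: the image of a K_d in the
    -- neighbourhood of the vertex x mapped to v is a monochromatic K_d among the
    -- spokes of that colour.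
    copy-through-v : ∀ {col} (e : Embedding (H t d) F) →
      (∀ u u′ → adj (H t d) u u′ ≡ true → colour extended (map e u) (map e u′) ≡ col) →
      ∀ x → map e x ≡ v → HasClique col (Spokes col) d
    copy-through-v {col} e mono x ex≡v with neighbour-clique x
    ... | w , x~w , w-clique = clique-from-vertices d g g-spoke g-clique
      where
      -- The neighbours w k of x are not mapped to v, since e is injective.
      v≢w : ∀ k → v ≢ map e (w k)
      v≢w k v≡ewk with injective e (trans ex≡v v≡ewk)
      ... | refl with trans (sym (x~w k)) (Hloop t d x)
      ...   | ()
      g : Fin d → Fin n
      g k = punchOut (v≢w k)
      spoke-colour : ∀ k → R (g k) ≡ col
      spoke-colour k = trans (sym (extended-spoke (v≢w k)))
        (subst (λ a → colour extended a (map e (w k)) ≡ col) ex≡v (mono x (w k) (x~w k)))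
      spoke-edge : ∀ k → g k ∈ N
      spoke-edge k = trans (cong (adj F v) (punchIn-punchOut (v≢w k)))
        (subst (λ a → adj F a (map e (w k)) ≡ true) ex≡v (preserves e x (w k) (x~w k)))
      g-spoke : ∀ k → g k ∈ Spokes col
      g-spoke k = ∩-intro (spoke-edge k) (dec-true (R (g k) B.≟ col) (spoke-colour k))
      g-clique : ∀ k l → k ≢ l → adj F-v (g k) (g l) ≡ true × colour c (g k) (g l) ≡ col
      g-clique k l k≢l =
        trans (adj-F-v (v≢w k) (v≢w l)) (preserves e (w k) (w l) (w-clique k l k≢l)) ,
        trans (sym (extended-inner (v≢w k) (v≢w l))) (mono (w k) (w l) (w-clique k l k≢l))

    spokes-clique-free : ¬ HasClique true R d → ¬ HasClique false (N ∖ R) d →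
                         ∀ col → ¬ HasClique col (Spokes col) d
    spokes-clique-free noRed noBlue true  =
      noRed ∘ hasClique-mono d λ i h → witness (R i B.≟ true) (∩-right h)
    spokes-clique-free noRed noBlue false =
      noBlue ∘ hasClique-mono d λ i h → ∖-intro (∩-left h) (witness (R i B.≟ false) (∩-right h))

  -- Colour the spokes by a good split of N (no red K_d in R, no blue K_d in
  -- N ∖ R); then every monochromatic copy of H_{t,d} avoids v.
  deletion-arrows : Arrows F (H t d) → size N < d * d → Arrows F-v (H t d)
  deletion-arrows arrows small c with Splitting.split-small F-v c d d′ N small
  ... | R , noRed , noBlue with arrows (Extension.extended c R)
  ... | col , e , mono with any? (λ x → map e x ≟ v)
  ... | no avoids =
    col , Extension.avoiding-copy c R e (λ u v≡eu → avoids (u , sym v≡eu)) mono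
  ... | yes (x , ex≡v) =
    ⊥-elim (spokes-clique-free c R noRed noBlue col (copy-through-v c R e mono x ex≡v))

corollary3p3 : (t d : ℕ) → d ≤ t →
    (n : ℕ) (F : Graph n) → RamseyMinimal F (H t d) → MinDegreeAtLeast F (d * d)
corollary3p3 t zero     _   n       F _                  v  = z≤n
corollary3p3 t (suc d′) _   zero    F _                  ()
corollary3p3 t (suc d′) d≤t (suc n) F (arrows , minimal) v with suc d′ * suc d′ ≤? degree F v
... | yes large = large
... | no  small =
  ⊥-elim (minimal n F-v deletion deletion-proper (deletion-arrows arrows (N-small (≰⇒> small))))
  where
  open Deletion F v
  open LowDegreeDeletion d≤t F v
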